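{- Let $G$ be a $2$-closed claw-free graph. Then $E(G)$ can be covered by a system $\mathcal{K}$ of cliques so that every vertex of $G$ belongs to at most three cliques of $\mathcal{K}$. Furthermore, if a vertex belongs to three cliques of $\mathcal{K}$, then these are the only maximal cliques of $G$ containing this vertex.
   Context: Graphs are finite and simple; a clique is a complete subgraph (not necessarily maximal); a system of cliques covers $E(G)$ if every edge lies in some clique of the system. A graph is claw-free if it has no induced $K_{1,3}$. For a vertex $x$, the local completion $G^*_x$ is obtained by adding all edges among vertices of $N_G(x)$. The $2$-closure of $G$ is obtained by repeatedly performing local completion at vertices whose neighbourhood induces a non-complete $2$-connected graph, as long as possible; $G$ is $2$-closed if it is isomorphic to its $2$-closure (equivalently, no vertex has a neighbourhood inducing a non-complete $2$-connected graph). -}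

module Defs where

open import Data.Nat using (ℕ; _≤_)
open import Data.Fin using (Fin)
open import Data.Fin.Subset using (Subset; _∈_; _⊆_)
open import Data.Fin.Subset.Properties using (_∈?_)
open import Data.List using (List; length; filter)
open import Data.List.Membership.Propositional using () renaming (_∈_ to _∈ₗ_)
open import Data.Product using (Σ; ∃; ∃-syntax; _×_; _,_)
open import Data.Empty using (⊥)
open import Relation.Nullary using (¬_; Dec)
open import Relation.Binary.PropositionalEquality using (_≡_; _≢_)

record Graph : Set₁ where
  field
    n      : ℕ
    Adj    : Fin n → Fin n → Set
    adj?   : ∀ u v → Dec (Adj u v)
    sym    : ∀ {u v} → Adj u v → Adj v u
    irrefl : ∀ {u} → ¬ Adj u u

module _ (G : Graph) where
  open Graph G

  -- vertex sets given as predicates (used for induced subgraphs)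
  VSet : Set₁
  VSet = Fin n → Set

  N : Fin n → VSet
  N x y = Adj x y

  _∖_ : VSet → Fin n → VSet
  (S ∖ w) y = S y × y ≢ w

  data Reach (S : VSet) : Fin n → Fin n → Set where
    here : ∀ {u} → S u → Reach S u u
    step : ∀ {u w v} → S u → Adj u w → Reach S w v → Reach S u v

  Connected : VSet → Set
  Connected S = ∀ u v → S u → S v → Reach S u v

  TwoConnected : VSet → Set
  TwoConnected S =
    (∃[ a ] ∃[ b ] ∃[ c ] (S a × S b × S c × a ≢ b × a ≢ c × b ≢ c))
    × Connected S
    × (∀ w → S w → Connected (S ∖ w))

  Complete : VSet → Set
  Complete S = ∀ u v → S u → S v → u ≢ v → Adj u v

  TwoClosed : Set
  TwoClosed = ∀ x → TwoConnected (N x) → Complete (N x)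

  ClawFree : Set
  ClawFree = ∀ x a b c → Adj x a → Adj x b → Adj x c →
    a ≢ b → a ≢ c → b ≢ c →
    ¬ Adj a b → ¬ Adj a c → ¬ Adj b c → ⊥

  IsClique : Subset n → Set
  IsClique K = ∀ u v → u ∈ K → v ∈ K → u ≢ v → Adj u v

  IsMaximalClique : Subset n → Set
  IsMaximalClique K = IsClique K × (∀ K′ → IsClique K′ → K ⊆ K′ → K′ ≡ K)

  Covers : List (Subset n) → Set
  Covers Ks = ∀ u v → Adj u v → ∃[ K ] (K ∈ₗ Ks × u ∈ K × v ∈ K)

  cliquesAt : List (Subset n) → Fin n → List (Subset n)
  cliquesAt Ks v = filter (v ∈?_) Ks

  countAt : List (Subset n) → Fin n → ℕ
  countAt Ks v = length (cliquesAt Ks v)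

-- Take the system of all maximal cliques; it suffices that no vertex x lies in
-- four of them.  Two distinct maximal cliques through x show that N(x) is not
-- complete.  If N(x) - w were disconnected for some w (or N(x) itself, the case
-- w = x), claw-freeness would split it into two cliques P and Q with no edges
-- between them.  Every maximal clique through x then lies in {x, w} ∪ P or in
-- {x, w} ∪ Q, and is determined by which of the two and by whether it contains
-- w; moreover the two kinds cannot both avoid w, since a non-neighbour of w
-- from each would form a claw with w at x.  That leaves room for only three
-- maximal cliques, so with four of them N(x) is 2-connected and not complete,
-- contradicting 2-closedness.
module Submission where

open import Defs
open import Data.Nat as ℕ using (_≤_; _<_; z≤n; s≤s; _≤?_)
open import Data.Nat.Properties using (≤-trans; ≤⇒≯; ≰⇒>)
open import Data.Bool.Properties using () renaming (_≟_ to _≟ᵇ_)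
open import Data.Fin using (Fin; zero; suc; _≟_)
open import Data.Fin.Patterns using (0F; 1F; 2F)
open import Data.Fin.Properties using (any?; all?; injective⇒≤)
open import Data.Fin.Subset using (Subset; _∈_; _∉_; _⊆_; _∪_; ⁅_⁆; ∣_∣; inside; outside)
open import Data.Fin.Subset.Properties
  using (_∈?_; _⊆?_; anySubset?; ⊆-antisym; p⊂q⇒∣p∣<∣q∣; p⊆p∪q; q⊆p∪q; x∈p∪q⁻; x∈p∪q⁺; x∈⁅x⁆; x∈⁅y⁆⇒x≡y)
open import Data.Vec using ([]; _∷_)
open import Data.Vec.Properties using (≡-dec)
open import Data.List using (List; []; _∷_; _++_; map; filter; length; lookup; deduplicate)
open import Data.List.Extrema.Nat using (argmax; argmax-all; f[xs]≤f[argmax])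
open import Data.List.Relation.Unary.All as All using (All; []; _∷_)
open import Data.List.Relation.Unary.All.Properties using (all-filter)
open import Data.List.Relation.Unary.AllPairs using ([]; _∷_)
open import Data.List.Relation.Unary.Any using (here; there)
open import Data.List.Relation.Unary.Unique.Propositional using (Unique)
open import Data.List.Relation.Unary.Unique.Propositional.Properties using (filter⁺)
open import Data.List.Membership.Propositional using () renaming (_∈_ to _∈ₗ_)
open import Data.List.Membership.Propositional.Properties
  using (∈-lookup; ∈-map⁺; ∈-++⁺ˡ; ∈-++⁺ʳ; ∈-filter⁺; ∈-filter⁻; ∈-deduplicate⁺; ∈-deduplicate⁻)
open import Data.Product using (∃; ∃₂; ∃-syntax; _×_; _,_; proj₁; proj₂; uncurry)
open import Data.Sum using (_⊎_; inj₁; inj₂; [_,_]′; map₂)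
open import Data.Empty using (⊥; ⊥-elim)
open import Function using (_∘_; id; const)
open import Relation.Nullary using (¬_; Dec; yes; no; ¬?)
open import Relation.Nullary.Decidable using (_×-dec_; _→-dec_; map′; decidable-stable)
open import Relation.Unary using (Decidable)
open import Relation.Binary.Definitions using (DecidableEquality)
open import Relation.Binary.PropositionalEquality using (_≡_; _≢_; refl; sym; trans; subst; cong)
import Data.List.Relation.Unary.Unique.DecPropositional.Properties as UniqueDec

subsets : ∀ m → List (Subset m)
subsets ℕ.zero    = [] ∷ []
subsets (ℕ.suc m) = map (inside ∷_) (subsets m) ++ map (outside ∷_) (subsets m)

∈-subsets : ∀ {m} (p : Subset m) → p ∈ₗ subsets m
∈-subsets []            = here refl
∈-subsets (inside ∷ p)  = ∈-++⁺ˡ (∈-map⁺ (inside ∷_) (∈-subsets p))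
∈-subsets (outside ∷ p) = ∈-++⁺ʳ (map (inside ∷_) (subsets _)) (∈-map⁺ (outside ∷_) (∈-subsets p))

_≟ₛ_ : ∀ {m} → DecidableEquality (Subset m)
_≟ₛ_ = ≡-dec _≟ᵇ_

module _ {A : Set} where

  lookup-injective : ∀ {xs : List A} → Unique xs → ∀ i j → lookup xs i ≡ lookup xs j → i ≡ j
  lookup-injective {_ ∷ _} _               zero    zero    _  = refl
  lookup-injective {_ ∷ _} (x≢xs ∷ _)      zero    (suc j) eq = ⊥-elim (All.lookup x≢xs (∈-lookup j) eq)
  lookup-injective {_ ∷ _} (x≢xs ∷ _)      (suc i) zero    eq = ⊥-elim (All.lookup x≢xs (∈-lookup i) (sym eq))
  lookup-injective {_ ∷ _} (_ ∷ xs-unique) (suc i) (suc j) eq = cong suc (lookup-injective xs-unique i j eq)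

  injectiveOn⇒length≤ : ∀ {m} (f : A → Fin m) {xs : List A} → Unique xs →
    (∀ {a b} → a ∈ₗ xs → b ∈ₗ xs → f a ≡ f b → a ≡ b) → length xs ≤ m
  injectiveOn⇒length≤ f {xs} xs-unique f-injective = injective⇒≤ {f = f ∘ lookup xs} λ {i} {j} eq →
    lookup-injective xs-unique i j (f-injective (∈-lookup i) (∈-lookup j) eq)

  two-distinct : ∀ {xs : List A} → Unique xs → 2 ≤ length xs → ∃₂ λ a b → a ∈ₗ xs × b ∈ₗ xs × a ≢ b
  two-distinct {[]}        _                ()
  two-distinct {_ ∷ []}    _                (s≤s ())
  two-distinct {a ∷ b ∷ _} ((a≢b ∷ _) ∷ _) _ = a , b , here refl , there (here refl) , a≢b

module _ (G : Graph) where
  open Graph G renaming (sym to adj-sym)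

  MaximalAt : Fin n → Subset n → Set
  MaximalAt x K = IsMaximalClique G K × x ∈ K

  N[_] : Fin n → VSet G
  N[ a ] b = a ≡ b ⊎ Adj a b

  N[]-sym : ∀ {a b} → N[ a ] b → N[ b ] a
  N[]-sym (inj₁ refl) = inj₁ refl
  N[]-sym (inj₂ ab)   = inj₂ (adj-sym ab)

  N[_]? : ∀ a → Decidable N[ a ]
  N[ a ]? b with a ≟ b | adj? a b
  ... | yes a≡b | _      = yes (inj₁ a≡b)
  ... | no _    | yes ab = yes (inj₂ ab)
  ... | no a≢b  | no ¬ab = no [ a≢b , ¬ab ]′

  step⁼ : ∀ {S a b v} → S a → N[ a ] b → Reach G S b v → Reach G S a v
  step⁼ _  (inj₁ refl) r = r
  step⁼ Sa (inj₂ ab)   r = step Sa ab r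

  Reach-source : ∀ {S u v} → Reach G S u v → S u
  Reach-source (here Su)     = Su
  Reach-source (step Su _ _) = Su

  nonadjacent⇒middle : ∀ {S z p} → Reach G S z p → z ≢ p → ¬ Adj z p → ∃[ y ] (S y × z ≢ y × p ≢ y)
  nonadjacent⇒middle (here _)      z≢p _   = ⊥-elim (z≢p refl)
  nonadjacent⇒middle (step _ zy r) _   ¬zp =
    _ , Reach-source r , (λ { refl → irrefl zy }) , (λ { refl → ¬zp zy })

  clique? : Decidable (IsClique G)
  clique? K = all? λ u → all? λ v → (u ∈? K) →-dec ((v ∈? K) →-dec (¬? (u ≟ v) →-dec adj? u v))

  ⁅⁆-clique : ∀ u → IsClique G ⁅ u ⁆
  ⁅⁆-clique u a b a∈ b∈ a≢b = ⊥-elim (a≢b (trans (x∈⁅y⁆⇒x≡y u a∈) (sym (x∈⁅y⁆⇒x≡y u b∈))))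

  ∪-clique : ∀ {K K′} → IsClique G K → IsClique G K′ →
    (∀ a b → a ∈ K → b ∈ K′ → a ≢ b → Adj a b) → IsClique G (K ∪ K′)
  ∪-clique {K} {K′} cK cK′ cross a b a∈ b∈ a≢b with x∈p∪q⁻ K K′ a∈ | x∈p∪q⁻ K K′ b∈
  ... | inj₁ aK  | inj₁ bK  = cK a b aK bK a≢b
  ... | inj₁ aK  | inj₂ bK′ = cross a b aK bK′ a≢b
  ... | inj₂ aK′ | inj₁ bK  = adj-sym (cross b a bK aK′ (a≢b ∘ sym))
  ... | inj₂ aK′ | inj₂ bK′ = cK′ a b aK′ bK′ a≢b

  edge-clique : ∀ {u v} → Adj u v → IsClique G (⁅ u ⁆ ∪ ⁅ v ⁆)
  edge-clique {u} {v} uv = ∪-clique (⁅⁆-clique u) (⁅⁆-clique v) cross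
    where
    cross : ∀ a b → a ∈ ⁅ u ⁆ → b ∈ ⁅ v ⁆ → a ≢ b → Adj a b
    cross a b a∈ b∈ _ rewrite x∈⁅y⁆⇒x≡y u a∈ | x∈⁅y⁆⇒x≡y v b∈ = uv

  maximal-∪-clique⇒≡ : ∀ {K K′} → IsMaximalClique G K → IsMaximalClique G K′ → IsClique G (K ∪ K′) → K ≡ K′
  maximal-∪-clique⇒≡ {K} {K′} (_ , K-max) (_ , K′-max) c =
    trans (sym (K-max _ c (p⊆p∪q K′))) (K′-max _ c (q⊆p∪q K K′))

  maximal-nonNeighbour : ∀ {K w} → IsMaximalClique G K → w ∉ K → ∃[ p ] (p ∈ K × ¬ Adj w p)
  maximal-nonNeighbour {K} {w} (cK , K-max) w∉K =
    decidable-stable (any? λ p → (p ∈? K) ×-dec ¬? (adj? w p)) λ none →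
      w∉K (subst (w ∈_) (K∪w≡K none) (q⊆p∪q K ⁅ w ⁆ (x∈⁅x⁆ w)))
    where
    K∪w≡K : ¬ (∃[ p ] (p ∈ K × ¬ Adj w p)) → K ∪ ⁅ w ⁆ ≡ K
    K∪w≡K none = K-max _ (∪-clique cK (⁅⁆-clique w) cross) (p⊆p∪q ⁅ w ⁆)
      where
      cross : ∀ a b → a ∈ K → b ∈ ⁅ w ⁆ → a ≢ b → Adj a b
      cross a b aK b∈ _ rewrite x∈⁅y⁆⇒x≡y w b∈ =
        adj-sym (decidable-stable (adj? w a) λ ¬wa → none (a , aK , ¬wa))

  maximal-≢⇒∃∉ : ∀ {K K′} → IsClique G K → IsMaximalClique G K′ → K ≢ K′ → ∃[ z ] (z ∈ K′ × z ∉ K)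
  maximal-≢⇒∃∉ {K} {K′} cK (_ , K′-max) K≢K′ =
    decidable-stable (any? λ z → (z ∈? K′) ×-dec ¬? (z ∈? K)) λ none →
      K≢K′ (K′-max K cK λ {z} zK′ → decidable-stable (z ∈? K) λ z∉K → none (z , zK′ , z∉K))

  maximal? : Decidable (IsMaximalClique G)
  maximal? K = clique? K ×-dec map′ noExtension⇒maximal maximal⇒noExtension (¬? (anySubset? extension?))
    where
    Extension : Subset n → Set
    Extension K′ = IsClique G K′ × K ⊆ K′ × K′ ≢ K
    extension? : Decidable Extension
    extension? K′ = clique? K′ ×-dec (K ⊆? K′) ×-dec ¬? (K′ ≟ₛ K)
    noExtension⇒maximal : ¬ ∃ Extension → ∀ K′ → IsClique G K′ → K ⊆ K′ → K′ ≡ K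
    noExtension⇒maximal none K′ cK′ K⊆K′ = decidable-stable (K′ ≟ₛ K) λ K′≢K → none (K′ , cK′ , K⊆K′ , K′≢K)
    maximal⇒noExtension : (∀ K′ → IsClique G K′ → K ⊆ K′ → K′ ≡ K) → ¬ ∃ Extension
    maximal⇒noExtension K-max (K′ , cK′ , K⊆K′ , K′≢K) = K′≢K (K-max K′ cK′ K⊆K′)

  clique⊆maximal : ∀ {K} → IsClique G K → ∃[ M ] (IsMaximalClique G M × K ⊆ M)
  clique⊆maximal {K} cK = M , (proj₁ M-extends , M-maximal) , proj₂ M-extends
    where
    Extends : Subset n → Set
    Extends C = IsClique G C × K ⊆ C
    extends? : Decidable Extends
    extends? C = clique? C ×-dec (K ⊆? C)
    M : Subset n
    M = argmax ∣_∣ K (filter extends? (subsets n))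
    M-extends : Extends M
    M-extends = argmax-all ∣_∣ (cK , λ {_} zK → zK) (all-filter extends? (subsets n))
    M-maximal : ∀ C → IsClique G C → M ⊆ C → C ≡ M
    M-maximal C cC M⊆C = ⊆-antisym (λ {z} zC → decidable-stable (z ∈? M) λ z∉M →
        ≤⇒≯ ∣C∣≤∣M∣ (p⊂q⇒∣p∣<∣q∣ (M⊆C , z , zC , z∉M))) M⊆C
      where
      ∣C∣≤∣M∣ : ∣ C ∣ ≤ ∣ M ∣
      ∣C∣≤∣M∣ = All.lookup (f[xs]≤f[argmax] {f = ∣_∣} K (filter extends? (subsets n)))
        (∈-filter⁺ extends? (∈-subsets C) (cC , λ zK → M⊆C (proj₂ M-extends zK)))

  distinctMaximal⇒nonadjacentNeighbours : ∀ {x K K′} → MaximalAt x K → MaximalAt x K′ → K ≢ K′ →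
    ∃₂ λ z p → Adj x z × Adj x p × z ≢ p × ¬ Adj z p
  distinctMaximal⇒nonadjacentNeighbours {x} {K} (K-max , xK) (K′-max , xK′) K≢K′
    with maximal-≢⇒∃∉ (proj₁ K-max) K′-max K≢K′
  ... | z , zK′ , z∉K with maximal-nonNeighbour K-max z∉K
  ... | p , pK , ¬zp = z , p , xz , xp , (λ { refl → z∉K pK }) , ¬zp
    where
    xz : Adj x z
    xz = proj₁ K′-max x z xK′ zK′ λ { refl → z∉K xK }
    xp : Adj x p
    xp = proj₁ K-max x p xK pK λ { refl → ¬zp (adj-sym xz) }

  module _ (claw-free : ClawFree G) where

    claw : ∀ {x a b c} → Adj x a → Adj x b → Adj x c → ¬ N[ a ] b → ¬ N[ a ] c → ¬ N[ b ] c → ⊥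
    claw {x} {a} {b} {c} xa xb xc ¬ab ¬ac ¬bc =
      claw-free x a b c xa xb xc (¬ab ∘ inj₁) (¬ac ∘ inj₁) (¬bc ∘ inj₁) (¬ab ∘ inj₂) (¬ac ∘ inj₂) (¬bc ∘ inj₂)

    nonNeighbours-complete : ∀ {x c} → Adj x c → Complete G (λ a → Adj x a × ¬ N[ c ] a)
    nonNeighbours-complete xc a b (xa , ¬ca) (xb , ¬cb) a≢b = decidable-stable (adj? a b) λ ¬ab →
      claw xa xb xc [ a≢b , ¬ab ]′ (¬ca ∘ N[]-sym) (¬cb ∘ N[]-sym)

    record CliqueSplit (S : VSet G) : Set₁ where
      field
        P Q          : VSet G
        P?           : Decidable P
        P⊆S          : ∀ {z} → P z → S z
        Q⊆S          : ∀ {z} → Q z → S z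
        cover        : ∀ {z} → S z → P z ⊎ Q z
        P-complete   : Complete G P
        Q-complete   : Complete G Q
        anticomplete : ∀ {p q} → P p → Q q → p ≢ q × ¬ Adj p q

    -- Either a walk u - p - q - v exists, or the closed neighbourhoods of u
    -- and of v in S are anticomplete, and then they split S.
    reach⊎split : ∀ {x} {S : VSet G} → Decidable S → (∀ {z} → S z → Adj x z) →
      ∀ {u v} → S u → S v → Reach G S u v ⊎ CliqueSplit S
    reach⊎split {x} {S} S? S⊆N {u} {v} Su Sv
      with any? (λ p → any? λ q → (S? p ×-dec N[ u ]? p) ×-dec (S? q ×-dec N[ v ]? q) ×-dec N[ p ]? q)
    ... | yes (p , q , (Sp , up) , (Sq , vq) , pq) =
      inj₁ (step⁼ Su up (step⁼ Sp pq (step⁼ Sq (N[]-sym vq) (here Sv))))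
    ... | no none = inj₂ record
      { P = P ; Q = Q ; P? = λ z → S? z ×-dec N[ u ]? z ; P⊆S = proj₁ ; Q⊆S = proj₁ ; cover = cover
      ; P-complete = far-complete (S⊆N Sv) P-far-from-v
      ; Q-complete = far-complete (S⊆N Su) Q-far-from-u
      ; anticomplete = anticomplete }
      where
      P Q : VSet G
      P z = S z × N[ u ] z
      Q z = S z × N[ v ] z
      anticomplete : ∀ {p q} → P p → Q q → p ≢ q × ¬ Adj p q
      anticomplete Pp Qq = (λ p≡q → none (_ , _ , Pp , Qq , inj₁ p≡q)) , (λ pq → none (_ , _ , Pp , Qq , inj₂ pq))
      ¬N[u]v : ¬ N[ u ] v
      ¬N[u]v = uncurry [_,_]′ (anticomplete (Su , inj₁ refl) (Sv , inj₁ refl))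
      cover : ∀ {z} → S z → P z ⊎ Q z
      cover {z} Sz with N[ u ]? z | N[ v ]? z
      ... | yes uz | _      = inj₁ (Sz , uz)
      ... | no _   | yes vz = inj₂ (Sz , vz)
      ... | no ¬uz | no ¬vz = ⊥-elim (claw (S⊆N Su) (S⊆N Sv) (S⊆N Sz) ¬N[u]v ¬uz ¬vz)
      P-far-from-v : ∀ {a} → P a → Adj x a × ¬ N[ v ] a
      P-far-from-v (Sa , ua) = S⊆N Sa , λ va → proj₁ (anticomplete (Sa , ua) (Sa , va)) refl
      Q-far-from-u : ∀ {a} → Q a → Adj x a × ¬ N[ u ] a
      Q-far-from-u (Sa , va) = S⊆N Sa , λ ua → proj₁ (anticomplete (Sa , ua) (Sa , va)) refl
      far-complete : ∀ {R : VSet G} {c} → Adj x c → (∀ {a} → R a → Adj x a × ¬ N[ c ] a) → Complete G R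
      far-complete xc far a b Ra Rb = nonNeighbours-complete xc a b (far Ra) (far Rb)

    module ThreeSlots {x w : Fin n} (w∈N[x] : N[ x ] w) {S : VSet G}
      (N⊆ : ∀ {z} → Adj x z → w ≡ z ⊎ S z) (S⊆ : ∀ {z} → S z → Adj x z × w ≢ z)
      (split : CliqueSplit S) where
      open CliqueSplit split

      Side : VSet G → Subset n → Set
      Side R K = ∀ {z} → z ∈ K → x ≡ z ⊎ w ≡ z ⊎ R z

      classify : ∀ {K} → IsClique G K → x ∈ K → ∀ {z} → z ∈ K → x ≡ z ⊎ w ≡ z ⊎ P z ⊎ Q z
      classify cK xK {z} zK with x ≟ z
      ... | yes x≡z = inj₁ x≡z
      ... | no x≢z  = inj₂ (map₂ cover (N⊆ (cK x z xK zK x≢z)))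

      meets-P⇒Side-P : ∀ {K p} → IsClique G K → x ∈ K → p ∈ K → P p → Side P K
      meets-P⇒Side-P cK xK pK Pp {z} zK = map₂ (map₂ [ id , ⊥-elim ∘ ¬Q ]′) (classify cK xK zK)
        where
        ¬Q : ¬ Q z
        ¬Q Qz = uncurry (λ p≢z ¬pz → ¬pz (cK _ z pK zK p≢z)) (anticomplete Pp Qz)

      avoids-P⇒Side-Q : ∀ {K} → IsClique G K → x ∈ K → (∀ {z} → z ∈ K → ¬ P z) → Side Q K
      avoids-P⇒Side-Q cK xK avoids zK = map₂ (map₂ [ ⊥-elim ∘ avoids zK , id ]′) (classify cK xK zK)

      meets-P? : ∀ K → Dec (∃[ p ] (p ∈ K × P p))
      meets-P? K = any? λ p → (p ∈? K) ×-dec P? p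

      slot : Subset n → Fin 3
      slot K with w ∈? K | meets-P? K
      ... | yes _ | yes _ = 0F
      ... | yes _ | no _  = 1F
      ... | no _  | _     = 2F

      Slot : Subset n → Fin 3 → Set
      Slot K 0F = w ∈ K × Side P K
      Slot K 1F = w ∈ K × Side Q K
      Slot K 2F = w ∉ K × (Side P K ⊎ Side Q K)

      slot-sound : ∀ {K} → IsClique G K → x ∈ K → Slot K (slot K)
      slot-sound {K} cK xK with w ∈? K | meets-P? K
      ... | yes wK  | yes (_ , pK , Pp) = wK , meets-P⇒Side-P cK xK pK Pp
      ... | yes wK  | no avoids         = wK , avoids-P⇒Side-Q cK xK λ zK Pz → avoids (_ , zK , Pz)
      ... | no w∉K  | yes (_ , pK , Pp) = w∉K , inj₁ (meets-P⇒Side-P cK xK pK Pp)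
      ... | no w∉K  | no avoids         = w∉K , inj₂ (avoids-P⇒Side-Q cK xK λ zK Pz → avoids (_ , zK , Pz))

      Side⇒∈⊎ : ∀ {R K K′} → Side R K → x ∈ K′ → (w ∈ K → w ∈ K′) → ∀ {z} → z ∈ K → z ∈ K′ ⊎ R z
      Side⇒∈⊎ sK xK′ wK⇒wK′ zK with sK zK
      ... | inj₁ refl        = inj₁ xK′
      ... | inj₂ (inj₁ refl) = inj₁ (wK⇒wK′ zK)
      ... | inj₂ (inj₂ Rz)   = inj₂ Rz

      sameSide⇒≡ : ∀ {R K K′} → Complete G R → MaximalAt x K → MaximalAt x K′ →
        (w ∈ K → w ∈ K′) → (w ∈ K′ → w ∈ K) → Side R K → Side R K′ → K ≡ K′
      sameSide⇒≡ {R} {K} {K′} R-complete (K-max , xK) (K′-max , xK′) wK⇒wK′ wK′⇒wK sK sK′ =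
        maximal-∪-clique⇒≡ K-max K′-max (∪-clique (proj₁ K-max) (proj₁ K′-max) cross)
        where
        cross : ∀ a b → a ∈ K → b ∈ K′ → a ≢ b → Adj a b
        cross a b aK bK′ a≢b with Side⇒∈⊎ sK xK′ wK⇒wK′ aK | Side⇒∈⊎ sK′ xK wK′⇒wK bK′
        ... | inj₁ aK′ | _       = proj₁ K′-max a b aK′ bK′ a≢b
        ... | inj₂ _   | inj₁ bK = proj₁ K-max a b aK bK a≢b
        ... | inj₂ Ra  | inj₂ Rb = R-complete a b Ra Rb a≢b

      far-from-w : ∀ {R K} → IsMaximalClique G K → w ∉ K → Side R K → Adj x w → (∀ {z} → R z → S z) →
        ∃[ p ] (R p × ¬ N[ w ] p)
      far-from-w K-max w∉K sK xw R⊆S with maximal-nonNeighbour K-max w∉K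
      ... | p , pK , ¬wp with sK pK
      ... | inj₁ refl        = ⊥-elim (¬wp (adj-sym xw))
      ... | inj₂ (inj₁ refl) = ⊥-elim (w∉K pK)
      ... | inj₂ (inj₂ Rp)   = p , Rp , [ proj₂ (S⊆ (R⊆S Rp)) , ¬wp ]′

      -- A non-neighbour of w from each clique would form a claw with w at x.
      opposite-sides⇒⊥ : ∀ {K K′} → MaximalAt x K → IsMaximalClique G K′ → w ∉ K → w ∉ K′ →
        Side P K → Side Q K′ → ⊥
      opposite-sides⇒⊥ (K-max , xK) K′-max w∉K w∉K′ sK sK′ = [ (λ { refl → w∉K xK }) , claw-at-x ]′ w∈N[x]
        where
        claw-at-x : Adj x w → ⊥
        claw-at-x xw with far-from-w K-max w∉K sK xw P⊆S | far-from-w K′-max w∉K′ sK′ xw Q⊆S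
        ... | p , Pp , ¬wp | q , Qq , ¬wq =
          claw (proj₁ (S⊆ (P⊆S Pp))) (proj₁ (S⊆ (Q⊆S Qq))) xw
            (uncurry [_,_]′ (anticomplete Pp Qq)) (¬wp ∘ N[]-sym) (¬wq ∘ N[]-sym)

      sameSlot⇒≡ : ∀ {K K′} → MaximalAt x K → MaximalAt x K′ → ∀ s → Slot K s → Slot K′ s → K ≡ K′
      sameSlot⇒≡ mK mK′ 0F (wK , sK) (wK′ , sK′) = sameSide⇒≡ P-complete mK mK′ (const wK′) (const wK) sK sK′
      sameSlot⇒≡ mK mK′ 1F (wK , sK) (wK′ , sK′) = sameSide⇒≡ Q-complete mK mK′ (const wK′) (const wK) sK sK′
      sameSlot⇒≡ mK mK′ 2F (w∉K , inj₁ sK) (w∉K′ , inj₁ sK′) =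
        sameSide⇒≡ P-complete mK mK′ (⊥-elim ∘ w∉K) (⊥-elim ∘ w∉K′) sK sK′
      sameSlot⇒≡ mK mK′ 2F (w∉K , inj₂ sK) (w∉K′ , inj₂ sK′) =
        sameSide⇒≡ Q-complete mK mK′ (⊥-elim ∘ w∉K) (⊥-elim ∘ w∉K′) sK sK′
      sameSlot⇒≡ mK mK′ 2F (w∉K , inj₁ sK) (w∉K′ , inj₂ sK′) =
        ⊥-elim (opposite-sides⇒⊥ mK (proj₁ mK′) w∉K w∉K′ sK sK′)
      sameSlot⇒≡ mK mK′ 2F (w∉K , inj₂ sK) (w∉K′ , inj₁ sK′) =
        ⊥-elim (opposite-sides⇒⊥ mK′ (proj₁ mK) w∉K′ w∉K sK′ sK)

      slot-injective : ∀ {K K′} → MaximalAt x K → MaximalAt x K′ → slot K ≡ slot K′ → K ≡ K′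
      slot-injective {K} {K′} mK mK′ eq = sameSlot⇒≡ mK mK′ (slot K) (slot-sound (proj₁ (proj₁ mK)) (proj₂ mK))
        (subst (Slot K′) (sym eq) (slot-sound (proj₁ (proj₁ mK′)) (proj₂ mK′)))

      atMostThree : ∀ {L} → Unique L → All (MaximalAt x) L → length L ≤ 3
      atMostThree L-unique L-maximal = injectiveOn⇒length≤ slot L-unique λ K∈L K′∈L →
        slot-injective (All.lookup L-maximal K∈L) (All.lookup L-maximal K′∈L)

    module ManyMaximalCliques (x : Fin n) {L} (L-unique : Unique L) (L-maximal : All (MaximalAt x) L)
      (long : 3 < length L) where

      split⇒⊥ : ∀ {w S} → N[ x ] w → (∀ {z} → Adj x z → w ≡ z ⊎ S z) → (∀ {z} → S z → Adj x z × w ≢ z) →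
        CliqueSplit S → ⊥
      split⇒⊥ w∈N[x] N⊆ S⊆ split = ≤⇒≯ (ThreeSlots.atMostThree w∈N[x] N⊆ S⊆ split L-unique L-maximal) long

      N-connected : Connected G (N G x)
      N-connected u v xu xv = [ id , ⊥-elim ∘ split⇒⊥ (inj₁ refl) inj₂ N⊆N∖x ]′ (reach⊎split (adj? x) id xu xv)
        where
        N⊆N∖x : ∀ {z} → Adj x z → Adj x z × x ≢ z
        N⊆N∖x xz = xz , λ { refl → irrefl xz }

      N∖-connected : ∀ w → N G x w → Connected G (_∖_ G (N G x) w)
      N∖-connected w xw u v Su Sv = [ id , ⊥-elim ∘ split⇒⊥ (inj₂ xw) N⊆ S⊆ ]′ (reach⊎split S? proj₁ Su Sv)
        where
        S? : Decidable (_∖_ G (N G x) w)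
        S? z = adj? x z ×-dec ¬? (z ≟ w)
        N⊆ : ∀ {z} → Adj x z → w ≡ z ⊎ _∖_ G (N G x) w z
        N⊆ {z} xz with z ≟ w
        ... | yes z≡w = inj₁ (sym z≡w)
        ... | no z≢w  = inj₂ (xz , z≢w)
        S⊆ : ∀ {z} → _∖_ G (N G x) w z → Adj x z × w ≢ z
        S⊆ (xz , z≢w) = xz , z≢w ∘ sym

      nonadjacent-neighbours : ∃₂ λ z p → Adj x z × Adj x p × z ≢ p × ¬ Adj z p
      nonadjacent-neighbours with two-distinct L-unique (≤-trans (s≤s (s≤s z≤n)) long)
      ... | K , K′ , K∈L , K′∈L , K≢K′ =
        distinctMaximal⇒nonadjacentNeighbours (All.lookup L-maximal K∈L) (All.lookup L-maximal K′∈L) K≢K′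

      N-twoConnected : TwoConnected G (N G x)
      N-twoConnected with nonadjacent-neighbours
      ... | z , p , xz , xp , z≢p , ¬zp with nonadjacent⇒middle (N-connected z p xz xp) z≢p ¬zp
      ... | y , xy , z≢y , p≢y = (z , p , y , xz , xp , xy , z≢p , z≢y , p≢y) , N-connected , N∖-connected

      N-notComplete : ¬ Complete G (N G x)
      N-notComplete N-complete with nonadjacent-neighbours
      ... | z , p , xz , xp , z≢p , ¬zp = ¬zp (N-complete z p xz xp z≢p)

    maximalAt-atMostThree : TwoClosed G → ∀ x {L} → Unique L → All (MaximalAt x) L → length L ≤ 3
    maximalAt-atMostThree two-closed x L-unique L-maximal = decidable-stable (_ ≤? 3) λ ≰3 →
      let open ManyMaximalCliques x L-unique L-maximal (≰⇒> ≰3)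
      in N-notComplete (two-closed x N-twoConnected)

  maximalCliques : List (Subset n)
  maximalCliques = deduplicate _≟ₛ_ (filter maximal? (subsets n))

  ∈-maximalCliques⁻ : ∀ {K} → K ∈ₗ maximalCliques → IsMaximalClique G K
  ∈-maximalCliques⁻ K∈ =
    proj₂ (∈-filter⁻ maximal? {xs = subsets n} (∈-deduplicate⁻ _≟ₛ_ (filter maximal? (subsets n)) K∈))

  ∈-maximalCliques⁺ : ∀ {K} → IsMaximalClique G K → K ∈ₗ maximalCliques
  ∈-maximalCliques⁺ {K} K-max = ∈-deduplicate⁺ _≟ₛ_ (∈-filter⁺ maximal? (∈-subsets K) K-max)

  maximalCliques-unique : Unique maximalCliques
  maximalCliques-unique = UniqueDec.deduplicate-! _≟ₛ_ (filter maximal? (subsets n))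

  maximalCliques-cover : Covers G maximalCliques
  maximalCliques-cover u v uv with clique⊆maximal (edge-clique uv)
  ... | M , M-max , uv⊆M =
    M , ∈-maximalCliques⁺ M-max , uv⊆M (x∈p∪q⁺ (inj₁ (x∈⁅x⁆ u))) , uv⊆M (x∈p∪q⁺ (inj₂ (x∈⁅x⁆ v)))

lemma16 : (G : Graph) → TwoClosed G → ClawFree G →
    ∃[ Ks ] (All (IsClique G) Ks
      × Covers G Ks
      × (∀ v → countAt G Ks v ≤ 3)
      × (∀ v → countAt G Ks v ≡ 3 →
          All (IsMaximalClique G) (cliquesAt G Ks v)
          × (∀ M → IsMaximalClique G M → v ∈ M → M ∈ₗ cliquesAt G Ks v)))
lemma16 G two-closed claw-free =
  maximalCliques G , All.tabulate (proj₁ ∘ ∈-maximalCliques⁻ G) , maximalCliques-cover G , count≤3 ,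
  -- every clique of the system is maximal, so the count need not be 3 here
  λ v _ → All.tabulate (proj₁ ∘ at v) , λ M M-max vM → ∈-filter⁺ (v ∈?_) (∈-maximalCliques⁺ G M-max) vM
  where
  at : ∀ v {K} → K ∈ₗ cliquesAt G (maximalCliques G) v → MaximalAt G v K
  at v K∈ with ∈-filter⁻ (v ∈?_) {xs = maximalCliques G} K∈
  ... | K∈M , vK = ∈-maximalCliques⁻ G K∈M , vK
  count≤3 : ∀ v → countAt G (maximalCliques G) v ≤ 3
  count≤3 v = maximalAt-atMostThree G claw-free two-closed v
    (filter⁺ (v ∈?_) (maximalCliques-unique G)) (All.tabulate (at v))
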